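{- Let $\Sigma$ be a one-sorted signature and let $t\colon \underline{n}\to\underline{m}$ be an arrow of $\mathbf{Th}[\Sigma]$ that can be obtained without using dischargers, i.e. built by $;$ and $\otimes$ from operators of $\Sigma$, identities, symmetries and duplicators. Then the cell $\langle t,\, t,\, id_{\underline{n}},\, id_{\underline{n}}\rangle$ is generated by the pullback basis $\mathcal{B}(\Sigma)$.
   Context: $\mathbf{Th}[\Sigma]$ is the free algebraic (Lawvere) theory of $\Sigma$: its objects are natural numbers $\underline{n}$; an arrow $\underline{n}\to\underline{m}$ is an $m$-tuple of $\Sigma$-terms over the variables $x_1,\dots,x_n$; composition $\alpha;\beta$ (diagrammatic order: $\alpha$ first) is substitution of the terms of $\alpha$ into $\beta$; $\alpha\otimes\beta$ is juxtaposition on disjoint variable blocks. An operator $f\in\Sigma$ of arity $n$ is the arrow $f\colon\underline{n}\to\underline{1}$. Auxiliary arrows: the symmetry $\gamma_{\underline{n},\underline{m}}=\langle x_{n+1},\dots,x_{n+m},x_1,\dots,x_n\rangle\colon\underline{n+m}\to\underline{m+n}$, the duplicator $\nabla_{\underline{n}}=\langle x_1,\dots,x_n,x_1,\dots,x_n\rangle\colon\underline{n}\to\underline{2n}$, and the discharger $!_{\underline{n}}\colon\underline{n}\to\underline{0}$ (empty tuple). A cell is a quadruple $\langle s,u,v,t\rangle$ of arrows of $\mathbf{Th}[\Sigma]$ with $s\colon o_1\to o_0$ (top), $u\colon o_2\to o_0$ (left), $v\colon o_3\to o_1$ (right), $t\colon o_3\to o_2$ (bottom), forming a commuting square $t;u=v;s$.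 Identity cells are $\langle h,id,id,h\rangle$ and $\langle id,v,v,id\rangle$. Horizontal composition: if $A=\langle s_1,u_1,v_1,t_1\rangle$, $B=\langle s_2,u_2,v_2,t_2\rangle$ with $v_1=u_2$, then $A*B=\langle s_2;s_1,u_1,v_2,t_2;t_1\rangle$. Vertical composition: if $t_1=s_2$, then $A\cdot B=\langle s_1,u_2;u_1,v_2;v_1,t_2\rangle$. Parallel composition: $A\otimes B$ componentwise. The pullback basis $\mathcal{B}(\Sigma)$ consists of the following cells, for every $f\in\Sigma$ of arity $n$: $R_f=\langle f,f,id_{\underline{n}},id_{\underline{n}}\rangle$, $D_f=\langle f\otimes id_{\underline{1}},\nabla_{\underline{1}},\nabla_{\underline{n}};(id_{\underline{n}}\otimes f),f\rangle$, $\hat D_f=\langle\nabla_{\underline{1}},f\otimes id_{\underline{1}},f,\nabla_{\underline{n}};(id_{\underline{n}}\otimes f)\rangle$, together with the signature-independent cells $R_\nabla=\langle\nabla_{\underline{1}},\nabla_{\underline{1}},id_{\underline{1}},id_{\underline{1}}\rangle$, $R_\gamma=\langle\gamma_{\underline{1},\underline{1}},\gamma_{\underline{1},\underline{1}},id_{\underline{2}},id_{\underline{2}}\rangle$, $D_\nabla=\langle\nabla_{\underline{1}}\otimes id_{\underline{1}},id_{\underline{1}}\otimes\nabla_{\underline{1}},\nabla_{\underline{1}},\nabla_{\underline{1}}\rangle$. A cell is generated by $\mathcal{B}(\Sigma)$ if it is obtained from cells of $\mathcal{B}(\Sigma)$ and identity cells by finitely many horizontal, vertical and parallel compositions. -}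

module Defs where

open import Data.Nat using (ℕ; zero; suc; _+_)
open import Data.Fin using (Fin; _↑ˡ_; _↑ʳ_)
open import Data.Vec using (Vec; []; _∷_; _++_; tabulate; [_]; lookup)
open import Data.Product using (Σ-syntax)
open import Relation.Binary.PropositionalEquality using (_≡_; refl)

record Signature : Set₁ where
  field
    Op : Set
    ar : Op → ℕ
open Signature public

module _ (S : Signature) where

  data Term (n : ℕ) : Set where
    var : Fin n → Term n
    op  : (f : Op S) → Vec (Term n) (ar S f) → Term n

  -- Arrows n → m of Th[Σ]: m-tuples of terms in n variables.
  Arrow : ℕ → ℕ → Set
  Arrow n m = Vec (Term n) m

module _ {S : Signature} where

  mutual
    substT : ∀ {n k} → Arrow S n k → Term S k → Term S n
    substT σ (var i) = lookup σ i
    substT σ (op f ts) = op f (substV σ ts)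

    substV : ∀ {n k l} → Arrow S n k → Vec (Term S k) l → Vec (Term S n) l
    substV σ [] = []
    substV σ (t ∷ ts) = substT σ t ∷ substV σ ts

  mutual
    renT : ∀ {n k} → (Fin k → Fin n) → Term S k → Term S n
    renT ρ (var i) = var (ρ i)
    renT ρ (op f ts) = op f (renV ρ ts)

    renV : ∀ {n k l} → (Fin k → Fin n) → Vec (Term S k) l → Vec (Term S n) l
    renV ρ [] = []
    renV ρ (t ∷ ts) = renT ρ t ∷ renV ρ ts

  idA : (n : ℕ) → Arrow S n n
  idA n = tabulate var

  -- composition in diagrammatic order: α first, then β (substitute α into β)
  _⨾_ : ∀ {n k m} → Arrow S n k → Arrow S k m → Arrow S n m
  α ⨾ β = substV α β
  infixl 5 _⨾_

  _⊗_ : ∀ {n m n′ m′} → Arrow S n m → Arrow S n′ m′ → Arrow S (n + n′) (m + m′)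
  _⊗_ {n} {m} {n′} α β = renV (λ i → i ↑ˡ n′) α ++ renV (λ i → n ↑ʳ i) β
  infixl 6 _⊗_

  opA : (f : Op S) → Arrow S (ar S f) 1
  opA f = [ op f (tabulate var) ]

  γA : (n m : ℕ) → Arrow S (n + m) (m + n)
  γA n m = tabulate (λ i → var (n ↑ʳ i)) ++ tabulate (λ i → var (i ↑ˡ m))

  ∇A : (n : ℕ) → Arrow S n (n + n)
  ∇A n = idA n ++ idA n

  !A : (n : ℕ) → Arrow S n 0
  !A n = []

  record Cell : Set where
    constructor cell
    field
      {o₀ o₁ o₂ o₃} : ℕ
      s : Arrow S o₁ o₀
      u : Arrow S o₂ o₀
      v : Arrow S o₃ o₁
      t : Arrow S o₃ o₂
      commutes : t ⨾ u ≡ v ⨾ s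

  data Generated : ∀ {o₀ o₁ o₂ o₃} → Arrow S o₁ o₀ → Arrow S o₂ o₀
                   → Arrow S o₃ o₁ → Arrow S o₃ o₂ → Set where
    R-op  : (f : Op S) → Generated (opA f) (opA f) (idA (ar S f)) (idA (ar S f))
    D-op  : (f : Op S) → Generated (opA f ⊗ idA 1) (∇A 1)
                                   (∇A (ar S f) ⨾ (idA (ar S f) ⊗ opA f)) (opA f)
    D̂-op  : (f : Op S) → Generated (∇A 1) (opA f ⊗ idA 1) (opA f)
                                   (∇A (ar S f) ⨾ (idA (ar S f) ⊗ opA f))
    R-∇   : Generated (∇A 1) (∇A 1) (idA 1) (idA 1)
    R-γ   : Generated (γA 1 1) (γA 1 1) (idA 2) (idA 2)
    D-∇   : Generated (∇A 1 ⊗ idA 1) (idA 1 ⊗ ∇A 1) (∇A 1) (∇A 1)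
    id-h  : ∀ {n m} (h : Arrow S n m) → Generated h (idA m) (idA n) h
    id-v  : ∀ {n m} (w : Arrow S n m) → Generated (idA m) w w (idA n)
    hor   : ∀ {a₀ a₁ a₂ a₃ b₁ b₃}
            {s₁ : Arrow S a₁ a₀} {u₁ : Arrow S a₂ a₀} {v₁ : Arrow S a₃ a₁} {t₁ : Arrow S a₃ a₂}
            {s₂ : Arrow S b₁ a₁} {v₂ : Arrow S b₃ b₁} {t₂ : Arrow S b₃ a₃}
            → Generated s₁ u₁ v₁ t₁ → Generated s₂ v₁ v₂ t₂
            → Generated (s₂ ⨾ s₁) u₁ v₂ (t₂ ⨾ t₁)
    ver   : ∀ {a₀ a₁ a₂ a₃ b₂ b₃}
            {s₁ : Arrow S a₁ a₀} {u₁ : Arrow S a₂ a₀} {v₁ : Arrow S a₃ a₁} {t₁ : Arrow S a₃ a₂}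
            {u₂ : Arrow S b₂ a₂} {v₂ : Arrow S b₃ a₃} {t₂ : Arrow S b₃ b₂}
            → Generated s₁ u₁ v₁ t₁ → Generated t₁ u₂ v₂ t₂
            → Generated s₁ (u₂ ⨾ u₁) (v₂ ⨾ v₁) t₂
    par   : ∀ {a₀ a₁ a₂ a₃ b₀ b₁ b₂ b₃}
            {s₁ : Arrow S a₁ a₀} {u₁ : Arrow S a₂ a₀} {v₁ : Arrow S a₃ a₁} {t₁ : Arrow S a₃ a₂}
            {s₂ : Arrow S b₁ b₀} {u₂ : Arrow S b₂ b₀} {v₂ : Arrow S b₃ b₁} {t₂ : Arrow S b₃ b₂}
            → Generated s₁ u₁ v₁ t₁ → Generated s₂ u₂ v₂ t₂
            → Generated (s₁ ⊗ s₂) (u₁ ⊗ u₂) (v₁ ⊗ v₂) (t₁ ⊗ t₂)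

  IsGenerated : Cell → Set
  IsGenerated c = Generated (Cell.s c) (Cell.u c) (Cell.v c) (Cell.t c)

  data DFExpr : ℕ → ℕ → Set where
    `op  : (f : Op S) → DFExpr (ar S f) 1
    `id  : (n : ℕ) → DFExpr n n
    `γ   : (n m : ℕ) → DFExpr (n + m) (m + n)
    `∇   : (n : ℕ) → DFExpr n (n + n)
    _`⨾_ : ∀ {n k m} → DFExpr n k → DFExpr k m → DFExpr n m
    _`⊗_ : ∀ {n m n′ m′} → DFExpr n m → DFExpr n′ m′ → DFExpr (n + n′) (m + m′)

  ⟦_⟧ : ∀ {n m} → DFExpr n m → Arrow S n m
  ⟦ `op f ⟧ = opA f
  ⟦ `id n ⟧ = idA n
  ⟦ `γ n m ⟧ = γA n m
  ⟦ `∇ n ⟧ = ∇A n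
  ⟦ d `⨾ e ⟧ = ⟦ d ⟧ ⨾ ⟦ e ⟧
  ⟦ d `⊗ e ⟧ = ⟦ d ⟧ ⊗ ⟦ e ⟧

  DischargeFree : ∀ {n m} → Arrow S n m → Set
  DischargeFree {n} {m} t = Σ[ d ∈ DFExpr n m ] ⟦ d ⟧ ≡ t

  reflCell : ∀ {n m} → Arrow S n m → Cell
  reflCell {n} t = cell t t (idA n) (idA n) refl

{-# OPTIONS --safe #-}
module Submission where

-- The cells ⟨t, t, id, id⟩ are closed under ; (the vertical composite of
-- ⟨e, e, id, id⟩ * ⟨d, id, id, d⟩ over ⟨d, d, id, id⟩) and under ⊗, and for
-- an operator, γ₁,₁ and ∇₁ they are the basis cells R_f, R_γ and R_∇.  So it
-- suffices to build every γₙ,ₘ and ∇ₙ from γ₁,₁, ∇₁ and identities by ; and ⊗: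
--   γₙ₊₁,ₘ = (id₁ ⊗ γₙ,ₘ) ; (γ₁,ₘ ⊗ idₙ),   ∇ₙ₊₁ = (∇₁ ⊗ ∇ₙ) ; (id₁ ⊗ γ₁,ₙ ⊗ idₙ),
-- and γ₁,ₘ₊₁ ⊗ idₙ = (γ₁,₁ ⊗ idₘ₊ₙ) ; (id₁ ⊗ γ₁,ₘ ⊗ idₙ).  These identities of
-- tuples of variables are checked componentwise.

open import Defs
open import Data.Nat using (ℕ; zero; suc; _+_)
open import Data.Fin using (Fin; zero; suc; _↑ˡ_; _↑ʳ_; splitAt; join)
open import Data.Fin.Properties using (join-splitAt)
open import Data.Sum using ([_,_])
open import Data.Vec using (Vec; _∷_; lookup; tabulate)
open import Data.Vec.Properties using (lookup-++ˡ; lookup-++ʳ; lookup∘tabulate)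
open import Data.Vec.Relation.Binary.Pointwise.Extensional using (ext; Pointwise-≡⇒≡)
open import Data.Product using (_,_)
open import Relation.Binary.PropositionalEquality
  using (_≡_; refl; sym; trans; cong; subst; module ≡-Reasoning)

ext-↑ˡ↑ʳ : ∀ {A : Set} a {b} {xs ys : Vec A (a + b)}
           → (∀ i → lookup xs (i ↑ˡ b) ≡ lookup ys (i ↑ˡ b))
           → (∀ j → lookup xs (a ↑ʳ j) ≡ lookup ys (a ↑ʳ j))
           → xs ≡ ys
ext-↑ˡ↑ʳ a {b} {xs} {ys} eqˡ eqʳ = Pointwise-≡⇒≡ (ext λ k →
  subst (λ k → lookup xs k ≡ lookup ys k) (join-splitAt a b k)
        ([_,_] {C = λ s → lookup xs (join a b s) ≡ lookup ys (join a b s)}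
               eqˡ eqʳ (splitAt a k)))

module _ {S : Signature} where

  lookup-renV : ∀ {n k l} (ρ : Fin k → Fin n) (ts : Vec (Term S k) l) i
                → lookup (renV ρ ts) i ≡ renT ρ (lookup ts i)
  lookup-renV ρ (t ∷ ts) zero    = refl
  lookup-renV ρ (t ∷ ts) (suc i) = lookup-renV ρ ts i

  lookup-⨾ : ∀ {n k m} (α : Arrow S n k) (β : Arrow S k m) i
             → lookup (α ⨾ β) i ≡ substT α (lookup β i)
  lookup-⨾ α (t ∷ β) zero    = refl
  lookup-⨾ α (t ∷ β) (suc i) = lookup-⨾ α β i

  lookup-⨾-var : ∀ {n k m} (α : Arrow S n k) (β : Arrow S k m) {i j}
                 → lookup β i ≡ var j → lookup (α ⨾ β) i ≡ lookup α j
  lookup-⨾-var α β {i} eq = trans (lookup-⨾ α β i) (cong (substT α) eq)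

  lookup-idA : ∀ {n} (i : Fin n) → lookup (idA {S = S} n) i ≡ var i
  lookup-idA = lookup∘tabulate var

  lookup-⊗ˡ : ∀ {n m n′ m′} (α : Arrow S n m) (β : Arrow S n′ m′) i
              → lookup (α ⊗ β) (i ↑ˡ m′) ≡ renT (_↑ˡ n′) (lookup α i)
  lookup-⊗ˡ {n′ = n′} α β i =
    trans (lookup-++ˡ (renV (_↑ˡ n′) α) _ i) (lookup-renV _ α i)

  lookup-⊗ʳ : ∀ {n m n′ m′} (α : Arrow S n m) (β : Arrow S n′ m′) j
              → lookup (α ⊗ β) (m ↑ʳ j) ≡ renT (n ↑ʳ_) (lookup β j)
  lookup-⊗ʳ {n} α β j =
    trans (lookup-++ʳ (renV _ α) (renV (n ↑ʳ_) β) j) (lookup-renV _ β j)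

  lookup-idA₁⊗ : ∀ {n m} (β : Arrow S n m) {i j}
                 → lookup β i ≡ var j → lookup (idA 1 ⊗ β) (suc i) ≡ var (suc j)
  lookup-idA₁⊗ β {i} eq = trans (lookup-⊗ʳ (idA 1) β i) (cong (renT suc) eq)

  lookup-γˡ : ∀ n m (i : Fin m) → lookup (γA {S = S} n m) (i ↑ˡ n) ≡ var (n ↑ʳ i)
  lookup-γˡ n m i =
    trans (lookup-++ˡ (tabulate λ i → var (n ↑ʳ i)) _ i) (lookup∘tabulate _ i)

  lookup-γʳ : ∀ n m (j : Fin n) → lookup (γA {S = S} n m) (m ↑ʳ j) ≡ var (j ↑ˡ m)
  lookup-γʳ n m j =
    trans (lookup-++ʳ (tabulate λ i → var (n ↑ʳ i)) _ j) (lookup∘tabulate _ j)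

  lookup-∇ˡ : ∀ n (i : Fin n) → lookup (∇A {S = S} n) (i ↑ˡ n) ≡ var i
  lookup-∇ˡ n i = trans (lookup-++ˡ (idA n) (idA n) i) (lookup-idA i)

  lookup-∇ʳ : ∀ n (i : Fin n) → lookup (∇A {S = S} n) (n ↑ʳ i) ≡ var i
  lookup-∇ʳ n i = trans (lookup-++ʳ (idA n) (idA n) i) (lookup-idA i)

  ⨾-identityʳ : ∀ {n k} (α : Arrow S n k) → α ⨾ idA k ≡ α
  ⨾-identityʳ {k = k} α =
    Pointwise-≡⇒≡ (ext λ i → lookup-⨾-var α (idA k) (lookup-idA i))

  idA-⊗ : ∀ n n′ → idA {S = S} n ⊗ idA n′ ≡ idA (n + n′)
  idA-⊗ n n′ = ext-↑ˡ↑ʳ n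
    (λ i → trans (lookup-⊗ˡ (idA n) (idA n′) i)
                 (trans (cong (renT (_↑ˡ n′)) (lookup-idA i))
                        (sym (lookup-idA (i ↑ˡ n′)))))
    (λ j → trans (lookup-⊗ʳ (idA n) (idA n′) j)
                 (trans (cong (renT (n ↑ʳ_)) (lookup-idA j))
                        (sym (lookup-idA (n ↑ʳ j)))))

  -- bubble m n = ⟨x₂,…,xₘ₊₁,x₁,xₘ₊₂,…,xₘ₊ₙ₊₁⟩ is γ₁,ₘ ⊗ idₙ, typed so that it
  -- composes with γₙ,ₘ and ∇ₙ without casts along m + suc n ≡ suc (m + n).
  bubble : ∀ m n → Arrow S (suc (m + n)) (m + suc n)
  bubble zero    n = idA (suc n)
  bubble (suc m) n = (γA 1 1 ⊗ idA (m + n)) ⨾ (idA 1 ⊗ bubble m n)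

  lookup-γ₁₁⊗idA : ∀ k (i : Fin k)
                   → lookup (γA {S = S} 1 1 ⊗ idA k) (suc (suc i)) ≡ var (suc (suc i))
  lookup-γ₁₁⊗idA k i =
    trans (lookup-⊗ʳ (γA 1 1) (idA k) i) (cong (renT (2 ↑ʳ_)) (lookup-idA i))

  lookup-bubble-suc : ∀ m n {i j} → lookup (bubble m n) i ≡ var j
                      → lookup (bubble (suc m) n) (suc i)
                        ≡ lookup (γA 1 1 ⊗ idA (m + n)) (suc j)
  lookup-bubble-suc m n {i} eq =
    lookup-⨾-var (γA 1 1 ⊗ idA (m + n)) (idA 1 ⊗ bubble m n) {suc i}
                 (lookup-idA₁⊗ (bubble m n) eq)

  lookup-bubble-↑ˡ : ∀ m n (i : Fin m)
                     → lookup (bubble m n) (i ↑ˡ suc n) ≡ var (suc (i ↑ˡ n))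
  lookup-bubble-↑ˡ (suc m) n zero    = refl
  lookup-bubble-↑ˡ (suc m) n (suc i) =
    trans (lookup-bubble-suc m n (lookup-bubble-↑ˡ m n i))
          (lookup-γ₁₁⊗idA (m + n) (i ↑ˡ n))

  lookup-bubble-↑ʳ-zero : ∀ m n → lookup (bubble m n) (m ↑ʳ zero) ≡ var zero
  lookup-bubble-↑ʳ-zero zero    n = refl
  lookup-bubble-↑ʳ-zero (suc m) n = lookup-bubble-suc m n (lookup-bubble-↑ʳ-zero m n)

  lookup-bubble-↑ʳ-suc : ∀ m n (j : Fin n)
                         → lookup (bubble m n) (m ↑ʳ suc j) ≡ var (suc (m ↑ʳ j))
  lookup-bubble-↑ʳ-suc zero    n j = lookup-idA (suc j)
  lookup-bubble-↑ʳ-suc (suc m) n j =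
    trans (lookup-bubble-suc m n (lookup-bubble-↑ʳ-suc m n j))
          (lookup-γ₁₁⊗idA (m + n) (m ↑ʳ j))

  γA-zero-suc : ∀ m → γA {S = S} 0 (suc m) ≡ idA 1 ⊗ γA 0 m
  γA-zero-suc m = ext-↑ˡ↑ʳ (suc m) ↑ˡ-case λ ()
    where
    ↑ˡ-case : ∀ i → lookup (γA 0 (suc m)) (i ↑ˡ 0) ≡ lookup (idA 1 ⊗ γA 0 m) (i ↑ˡ 0)
    ↑ˡ-case zero    = refl
    ↑ˡ-case (suc i) = trans (lookup-γˡ 0 (suc m) (suc i))
                            (sym (lookup-idA₁⊗ (γA 0 m) (lookup-γˡ 0 m i)))

  γA-suc : ∀ n m → γA {S = S} (suc n) m ≡ (idA 1 ⊗ γA n m) ⨾ bubble m n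
  γA-suc n m = ext-↑ˡ↑ʳ m ↑ˡ-case ↑ʳ-case
    where
    open ≡-Reasoning
    G = idA 1 ⊗ γA n m
    via-bubble : ∀ {i j} → lookup (bubble m n) i ≡ var j
                 → lookup (G ⨾ bubble m n) i ≡ lookup G j
    via-bubble = lookup-⨾-var G (bubble m n)

    ↑ˡ-case : ∀ i → lookup (γA (suc n) m) (i ↑ˡ suc n) ≡ lookup (G ⨾ bubble m n) (i ↑ˡ suc n)
    ↑ˡ-case i = begin
      lookup (γA (suc n) m) (i ↑ˡ suc n)   ≡⟨ lookup-γˡ (suc n) m i ⟩
      var (suc (n ↑ʳ i))                   ≡⟨ lookup-idA₁⊗ (γA n m) (lookup-γˡ n m i) ⟨
      lookup G (suc (i ↑ˡ n))              ≡⟨ via-bubble (lookup-bubble-↑ˡ m n i) ⟨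
      lookup (G ⨾ bubble m n) (i ↑ˡ suc n) ∎

    ↑ʳ-case : ∀ j → lookup (γA (suc n) m) (m ↑ʳ j) ≡ lookup (G ⨾ bubble m n) (m ↑ʳ j)
    ↑ʳ-case zero = begin
      lookup (γA (suc n) m) (m ↑ʳ zero)    ≡⟨ lookup-γʳ (suc n) m zero ⟩
      var zero                             ≡⟨ via-bubble (lookup-bubble-↑ʳ-zero m n) ⟨
      lookup (G ⨾ bubble m n) (m ↑ʳ zero)  ∎
    ↑ʳ-case (suc j) = begin
      lookup (γA (suc n) m) (m ↑ʳ suc j)   ≡⟨ lookup-γʳ (suc n) m (suc j) ⟩
      var (suc (j ↑ˡ m))                   ≡⟨ lookup-idA₁⊗ (γA n m) (lookup-γʳ n m j) ⟨
      lookup G (suc (m ↑ʳ j))              ≡⟨ via-bubble (lookup-bubble-↑ʳ-suc m n j) ⟨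
      lookup (G ⨾ bubble m n) (m ↑ʳ suc j) ∎

  ∇A-suc : ∀ n → ∇A {S = S} (suc n) ≡ (∇A 1 ⊗ ∇A n) ⨾ (idA 1 ⊗ bubble n n)
  ∇A-suc n = ext-↑ˡ↑ʳ (suc n) ↑ˡ-case ↑ʳ-case
    where
    open ≡-Reasoning
    D = ∇A 1 ⊗ ∇A n
    B = idA 1 ⊗ bubble n n
    via-bubble : ∀ {i j} → lookup (bubble n n) i ≡ var j
                 → lookup (D ⨾ B) (suc i) ≡ lookup D (suc j)
    via-bubble {i} eq = lookup-⨾-var D B {suc i} (lookup-idA₁⊗ (bubble n n) eq)

    ↑ˡ-case : ∀ i → lookup (∇A (suc n)) (i ↑ˡ suc n) ≡ lookup (D ⨾ B) (i ↑ˡ suc n)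
    ↑ˡ-case zero    = refl
    ↑ˡ-case (suc i) = begin
      lookup (∇A (suc n)) (suc i ↑ˡ suc n) ≡⟨ lookup-∇ˡ (suc n) (suc i) ⟩
      var (suc i)                          ≡⟨ cong (renT suc) (lookup-∇ˡ n i) ⟨
      renT suc (lookup (∇A n) (i ↑ˡ n))    ≡⟨ lookup-⊗ʳ (∇A 1) (∇A n) (i ↑ˡ n) ⟨
      lookup D (suc (suc (i ↑ˡ n)))        ≡⟨ via-bubble (lookup-bubble-↑ˡ n n i) ⟨
      lookup (D ⨾ B) (suc i ↑ˡ suc n)      ∎

    ↑ʳ-case : ∀ j → lookup (∇A (suc n)) (suc n ↑ʳ j) ≡ lookup (D ⨾ B) (suc n ↑ʳ j)
    ↑ʳ-case zero = begin
      lookup (∇A (suc n)) (suc n ↑ʳ zero)  ≡⟨ lookup-∇ʳ (suc n) zero ⟩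
      var zero                             ≡⟨ via-bubble (lookup-bubble-↑ʳ-zero n n) ⟨
      lookup (D ⨾ B) (suc n ↑ʳ zero)       ∎
    ↑ʳ-case (suc j) = begin
      lookup (∇A (suc n)) (suc n ↑ʳ suc j) ≡⟨ lookup-∇ʳ (suc n) (suc j) ⟩
      var (suc j)                          ≡⟨ cong (renT suc) (lookup-∇ʳ n j) ⟨
      renT suc (lookup (∇A n) (n ↑ʳ j))    ≡⟨ lookup-⊗ʳ (∇A 1) (∇A n) (n ↑ʳ j) ⟨
      lookup D (suc (suc (n ↑ʳ j)))        ≡⟨ via-bubble (lookup-bubble-↑ʳ-suc n n j) ⟨
      lookup (D ⨾ B) (suc n ↑ʳ suc j)      ∎

  record DischargeFreeClosed (Q : ∀ {n m} → Arrow S n m → Set) : Set where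
    field
      opA∈ : ∀ f → Q (opA f)
      idA∈ : ∀ n → Q (idA n)
      γ₁₁∈ : Q (γA 1 1)
      ∇₁∈  : Q (∇A 1)
      ⨾∈   : ∀ {n k m} {α : Arrow S n k} {β : Arrow S k m}
             → Q α → Q β → Q (α ⨾ β)
      ⊗∈   : ∀ {n m n′ m′} {α : Arrow S n m} {β : Arrow S n′ m′}
             → Q α → Q β → Q (α ⊗ β)

  module _ {Q : ∀ {n m} → Arrow S n m → Set} (closed : DischargeFreeClosed Q) where
    open DischargeFreeClosed closed

    bubble∈ : ∀ m n → Q (bubble m n)
    bubble∈ zero    n = idA∈ (suc n)
    bubble∈ (suc m) n = ⨾∈ (⊗∈ γ₁₁∈ (idA∈ (m + n))) (⊗∈ (idA∈ 1) (bubble∈ m n))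

    γA∈ : ∀ n m → Q (γA n m)
    γA∈ zero    zero    = idA∈ 0
    γA∈ zero    (suc m) = subst Q (sym (γA-zero-suc m)) (⊗∈ (idA∈ 1) (γA∈ zero m))
    γA∈ (suc n) m       =
      subst Q (sym (γA-suc n m)) (⨾∈ (⊗∈ (idA∈ 1) (γA∈ n m)) (bubble∈ m n))

    ∇A∈ : ∀ n → Q (∇A n)
    ∇A∈ zero    = idA∈ 0
    ∇A∈ (suc n) =
      subst Q (sym (∇A-suc n)) (⨾∈ (⊗∈ ∇₁∈ (∇A∈ n)) (⊗∈ (idA∈ 1) (bubble∈ n n)))

    ⟦⟧∈ : ∀ {n m} (d : DFExpr {S = S} n m) → Q ⟦ d ⟧
    ⟦⟧∈ (`op f)  = opA∈ f
    ⟦⟧∈ (`id n)  = idA∈ n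
    ⟦⟧∈ (`γ n m) = γA∈ n m
    ⟦⟧∈ (`∇ n)   = ∇A∈ n
    ⟦⟧∈ (d `⨾ e) = ⨾∈ (⟦⟧∈ d) (⟦⟧∈ e)
    ⟦⟧∈ (d `⊗ e) = ⊗∈ (⟦⟧∈ d) (⟦⟧∈ e)

  reflCell-⨾ : ∀ {n k m} {d : Arrow S n k} {e : Arrow S k m}
               → IsGenerated (reflCell d) → IsGenerated (reflCell e)
               → IsGenerated (reflCell (d ⨾ e))
  reflCell-⨾ {n} {k} {d = d} {e} gd ge =
    subst (λ v → Generated (d ⨾ e) (d ⨾ e) v (idA n)) (⨾-identityʳ (idA n))
          (ver (hor ge (id-h d)) gd′)
    where
    gd′ : Generated (d ⨾ idA k) d (idA n) (idA n)
    gd′ = subst (λ s → Generated s d (idA n) (idA n)) (sym (⨾-identityʳ d)) gd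

  reflCell-⊗ : ∀ {n m n′ m′} {d : Arrow S n m} {e : Arrow S n′ m′}
               → IsGenerated (reflCell d) → IsGenerated (reflCell e)
               → IsGenerated (reflCell (d ⊗ e))
  reflCell-⊗ {n} {n′ = n′} {d = d} {e} gd ge =
    subst (λ i → Generated (d ⊗ e) (d ⊗ e) i i) (idA-⊗ n n′) (par gd ge)

  reflCell-closed : DischargeFreeClosed (λ t → IsGenerated (reflCell t))
  reflCell-closed = record
    { opA∈ = R-op
    ; idA∈ = λ n → id-h (idA n)
    ; γ₁₁∈ = R-γ
    ; ∇₁∈  = R-∇
    ; ⨾∈   = reflCell-⨾
    ; ⊗∈   = reflCell-⊗
    }

lemma3p6 : (S : Signature) {n m : ℕ} (t : Arrow S n m)
           → DischargeFree t → IsGenerated (reflCell t)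
lemma3p6 S t (d , refl) = ⟦⟧∈ reflCell-closed d
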